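{- Let $k\geq 4$ and let $q,\Delta,A,B,C,D,W,X,Y,Z$ be integers. Let $\widetilde{M_k}$ be the $k$-by-$k$ integer matrix $$\widetilde{M_k} = \left[ \begin{matrix} 1 & 0 & 0 & \dots & 0 & 0 & A & B \\ -\Delta & 1 & 0 & \dots & 0 & 0 & C & D \\ q & -\Delta & 1 & \dots & 0 & 0 & 0 & 0 \\ \dots & \dots & \dots & \dots & \dots & \dots & \dots & \dots\\ 0 & 0 & 0 & \dots & 1 & 0 & 0 & 0 \\ 0 & 0 & 0 & \dots & -\Delta & 1 & 0 & 0 \\ 0 & 0 & 0 & \dots & q & -\Delta & W & X \\ 0 & 0 & 0 & \dots & 0 & q & Y & Z \end{matrix}\right],$$ that is: the first $k-2$ columns form a lower-triangular banded matrix with $1$ on the diagonal, $-\Delta$ on the first subdiagonal and $q$ on the second subdiagonal; the last two columns have entries $A,B$ in row $1$, $C,D$ in row $2$, $W,X$ in row $k-1$, $Y,Z$ in row $k$, and $0$ in rows $3$ through $k-2$. Then $\widetilde{M_k}$ is equivalent (via the integer row and column operations preserving Smith normal form: negating a row or column, adding an integer multiple of one row or column to another, swapping rows or columns), and hence has the same Smith normal form, as the block-diagonal matrix $$\left[ \begin{matrix} 1 & 0 & \dots & 0 & 0 & 0 \\ 0 & 1 & \dots & 0 & 0 & 0 \\ \dots & \dots & \dots & \dots & \dots & \dots\\ 0 & 0 & \dots & 1 & 0 & 0 \\ 0 & 0 & \dots & 0 & a & b \\ 0 & 0 & \dots & 0 & c & d \end{matrix}\right]$$ consisting of the $(k-2)$-by-$(k-2)$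 identity matrix and a $2$-by-$2$ block, where $$\left[ \begin{matrix} a & b \\ c & d \end{matrix}\right] = \left[ \begin{matrix} \Delta & 1 \\ -q & 0 \end{matrix}\right]^{k-2} \left[ \begin{matrix} A & B \\ C & D \end{matrix}\right] + \left[ \begin{matrix} W & X \\ Y & Z \end{matrix}\right].$$
   Context: This is a general Smith-normal-form reduction used to compute critical groups of $(q,t)$-deformed wheel graphs; in the applications $\Delta = 1+q+t$. -}

module Defs where

open import Data.Nat as ℕ using (ℕ; zero; suc; _∸_)
open import Data.Integer using (ℤ; 0ℤ; 1ℤ; -_; _+_; _*_)
open import Data.Fin using (Fin; toℕ)
import Data.Fin as Fin
open import Data.Bool using (if_then_else_)
open import Relation.Nullary using (does; ¬_)
open import Relation.Binary.PropositionalEquality using (_≡_)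
open import Relation.Binary.Construct.Closure.ReflexiveTransitive using (Star)
open import Data.Product using (∃)

Matrix : ℕ → ℕ → Set
Matrix m n = Fin m → Fin n → ℤ

negRow : ∀ {m n} → Fin m → Matrix m n → Matrix m n
negRow i M r c = if does (r Fin.≟ i) then - M r c else M r c

addRow : ∀ {m n} → Fin m → Fin m → ℤ → Matrix m n → Matrix m n
addRow i j a M r c = if does (r Fin.≟ i) then M i c + a * M j c else M r c

swapRow : ∀ {m n} → Fin m → Fin m → Matrix m n → Matrix m n
swapRow i j M r c =
  if does (r Fin.≟ i) then M j c else (if does (r Fin.≟ j) then M i c else M r c)

negCol : ∀ {m n} → Fin n → Matrix m n → Matrix m n
negCol i M r c = if does (c Fin.≟ i) then - M r c else M r c

addCol : ∀ {m n} → Fin n → Fin n → ℤ → Matrix m n → Matrix m n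
addCol i j a M r c = if does (c Fin.≟ i) then M r i + a * M r j else M r c

swapCol : ∀ {m n} → Fin n → Fin n → Matrix m n → Matrix m n
swapCol i j M r c =
  if does (c Fin.≟ i) then M r j else (if does (c Fin.≟ j) then M r i else M r c)

data ElemOp (m n : ℕ) : Set where
  opNegRow  : Fin m → ElemOp m n
  opAddRow  : (i j : Fin m) → ¬ (i ≡ j) → ℤ → ElemOp m n
  opSwapRow : Fin m → Fin m → ElemOp m n
  opNegCol  : Fin n → ElemOp m n
  opAddCol  : (i j : Fin n) → ¬ (i ≡ j) → ℤ → ElemOp m n
  opSwapCol : Fin n → Fin n → ElemOp m n

applyOp : ∀ {m n} → ElemOp m n → Matrix m n → Matrix m n
applyOp (opNegRow i)        = negRow i
applyOp (opAddRow i j _ a)  = addRow i j a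
applyOp (opSwapRow i j)     = swapRow i j
applyOp (opNegCol i)        = negCol i
applyOp (opAddCol i j _ a)  = addCol i j a
applyOp (opSwapCol i j)     = swapCol i j

Step : ∀ {m n} → Matrix m n → Matrix m n → Set
Step {m} {n} M N = ∃ λ (o : ElemOp m n) → ∀ r c → applyOp o M r c ≡ N r c

_∼_ : ∀ {m n} → Matrix m n → Matrix m n → Set
M ∼ N = Star Step M N

record M2 : Set where
  constructor m2
  field
    e11 e12 e21 e22 : ℤ
open M2 public

_⊗_ : M2 → M2 → M2
m2 a b c d ⊗ m2 a' b' c' d' =
  m2 (a * a' + b * c') (a * b' + b * d') (c * a' + d * c') (c * b' + d * d')

_⊕_ : M2 → M2 → M2
m2 a b c d ⊕ m2 a' b' c' d' = m2 (a + a') (b + b') (c + c') (d + d')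

id2 : M2
id2 = m2 1ℤ 0ℤ 0ℤ 1ℤ

_^2_ : M2 → ℕ → M2
P ^2 zero = id2
P ^2 suc e = P ⊗ (P ^2 e)

-- The matrix  M̃_k  (0-indexed: rows/cols 0..k-1; columns 0..k-3 banded,
-- columns k-2, k-1 hold  A B / C D  in rows 0,1 and  W X / Y Z  in rows k-2,k-1)

private
  _==_ : ℕ → ℕ → Data.Bool.Bool
  a == b = does (a ℕ.≟ b)
  _<ᵇ_ : ℕ → ℕ → Data.Bool.Bool
  a <ᵇ b = does (suc a ℕ.≤? b)

Mtilde-entry : (k : ℕ) (q Δ A B C D W X Y Z : ℤ) → ℕ → ℕ → ℤ
Mtilde-entry k q Δ A B C D W X Y Z i j =
  if j <ᵇ (k ∸ 2) then
    (if i == j then 1ℤ else if i == suc j then - Δ else if i == suc (suc j) then q else 0ℤ)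
  else if j == (k ∸ 2) then
    (if i == 0 then A else if i == 1 then C
     else if i == (k ∸ 2) then W else if i == (k ∸ 1) then Y else 0ℤ)
  else
    (if i == 0 then B else if i == 1 then D
     else if i == (k ∸ 2) then X else if i == (k ∸ 1) then Z else 0ℤ)

Mtilde : (k : ℕ) (q Δ A B C D W X Y Z : ℤ) → Matrix k k
Mtilde k q Δ A B C D W X Y Z i j =
  Mtilde-entry k q Δ A B C D W X Y Z (toℕ i) (toℕ j)

blockEntry : (k : ℕ) → M2 → ℕ → ℕ → ℤ
blockEntry k (m2 a b c d) i j =
  if i <ᵇ (k ∸ 2) then (if i == j then 1ℤ else 0ℤ)
  else if j <ᵇ (k ∸ 2) then 0ℤ
  else if i == (k ∸ 2) then (if j == (k ∸ 2) then a else b)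
  else (if j == (k ∸ 2) then c else d)

Block : (k : ℕ) → M2 → Matrix k k
Block k P i j = blockEntry k P (toℕ i) (toℕ j)

-- A unit pivot can be cleared by elementary operations, leaving 1 ⊕ S with S
-- its Schur complement. In M̃ the pivot row is (1, 0, …, 0, A, B) and the pivot
-- column is (1, -Δ, q, 0, …, 0)ᵀ, so S is again of the same shape, one size
-- smaller, with the top corner block replaced by [[Δ, 1], [-q, 0]] · [[A, B], [C, D]].
-- After k - 2 pivots only the identity and the stated 2 × 2 block remain. For the
-- induction the two corner blocks are added rather than overwritten, so that the
-- family still makes sense once they overlap in sizes 2 and 3.
module Submission where

open import Defs
open import Data.Nat using (ℕ; _≤_; _∸_; zero; suc; _<ᵇ_; _≡ᵇ_; s≤s; z≤n)
open import Data.Nat.Properties using (<⇒≤; ≤-refl)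
open import Data.Integer using (ℤ; -_; 0ℤ; 1ℤ; _+_; _*_; _-_)
import Data.Integer.Properties as ℤ
open import Data.Integer.Tactic.RingSolver using (solve-∀)
open import Data.Fin as Fin using (Fin; zero; suc; toℕ; fromℕ<)
open import Data.Fin.Properties using (suc-injective; toℕ-injective; toℕ-fromℕ<)
open import Data.Bool using (Bool; true; false; if_then_else_)
open import Relation.Nullary using (yes; no; does; contradiction)
open import Relation.Binary.PropositionalEquality
open import Relation.Binary.Construct.Closure.ReflexiveTransitive
  using (ε; _◅_; _◅◅_; gmap)
open import Data.Product using (_,_)
open import Function using (_∘_)

private variable m n : ℕ

infix 4 _≗ₘ_

_≗ₘ_ : Matrix m n → Matrix m n → Set
M ≗ₘ N = ∀ r c → M r c ≡ N r c

≗ₘ⇒∼ : {M N : Matrix (suc m) n} → M ≗ₘ N → M ∼ N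
≗ₘ⇒∼ {M = M} {N} M≗N = (opSwapRow zero zero , swap-self) ◅ ε
  where
  swap-self : swapRow zero zero M ≗ₘ N
  swap-self zero    c = M≗N zero c
  swap-self (suc r) c = M≗N (suc r) c

infix 30 _ᵀ

_ᵀ : Matrix m n → Matrix n m
(M ᵀ) i j = M j i

transposeOp : ElemOp m n → ElemOp n m
transposeOp (opNegRow i)          = opNegCol i
transposeOp (opAddRow i j i≢j a)  = opAddCol i j i≢j a
transposeOp (opSwapRow i j)       = opSwapCol i j
transposeOp (opNegCol i)          = opNegRow i
transposeOp (opAddCol i j i≢j a)  = opAddRow i j i≢j a
transposeOp (opSwapCol i j)       = opSwapRow i j

transposeOp-applyOp : (o : ElemOp m n) (M : Matrix m n) →
  applyOp (transposeOp o) (M ᵀ) ≗ₘ (applyOp o M) ᵀ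
transposeOp-applyOp (opNegRow i)       M r c = refl
transposeOp-applyOp (opAddRow i j _ a) M r c = refl
transposeOp-applyOp (opSwapRow i j)    M r c = refl
transposeOp-applyOp (opNegCol i)       M r c = refl
transposeOp-applyOp (opAddCol i j _ a) M r c = refl
transposeOp-applyOp (opSwapCol i j)    M r c = refl

ᵀ-∼ : {M N : Matrix m n} → M ∼ N → M ᵀ ∼ N ᵀ
ᵀ-∼ = gmap _ᵀ step
  where
  step : {M N : Matrix m n} → Step M N → Step (M ᵀ) (N ᵀ)
  step {M = M} (o , eq) = transposeOp o , λ r c → trans (transposeOp-applyOp o M r c) (eq c r)

infix 30 1⊕_

1⊕_ : Matrix m n → Matrix (suc m) (suc n)
(1⊕ M) zero    zero    = 1ℤ
(1⊕ M) zero    (suc c) = 0ℤ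
(1⊕ M) (suc r) zero    = 0ℤ
(1⊕ M) (suc r) (suc c) = M r c

1⊕-op : ElemOp m n → ElemOp (suc m) (suc n)
1⊕-op (opNegRow i)         = opNegRow (suc i)
1⊕-op (opAddRow i j i≢j a) = opAddRow (suc i) (suc j) (i≢j ∘ suc-injective) a
1⊕-op (opSwapRow i j)      = opSwapRow (suc i) (suc j)
1⊕-op (opNegCol i)         = opNegCol (suc i)
1⊕-op (opAddCol i j i≢j a) = opAddCol (suc i) (suc j) (i≢j ∘ suc-injective) a
1⊕-op (opSwapCol i j)      = opSwapCol (suc i) (suc j)

if-both : ∀ b {x y z : ℤ} → x ≡ z → y ≡ z → (if b then x else y) ≡ z
if-both true  x≡z _   = x≡z
if-both false _   y≡z = y≡z

0+a*0≡0 : ∀ a → 0ℤ + a * 0ℤ ≡ 0ℤ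
0+a*0≡0 a = trans (ℤ.+-identityˡ _) (ℤ.*-zeroʳ a)

1⊕-applyOp : (o : ElemOp m n) (M : Matrix m n) → applyOp (1⊕-op o) (1⊕ M) ≗ₘ 1⊕ (applyOp o M)
1⊕-applyOp (opNegRow i)       M zero    zero    = refl
1⊕-applyOp (opNegRow i)       M zero    (suc c) = refl
1⊕-applyOp (opNegRow i)       M (suc r) zero    = if-both _ refl refl
1⊕-applyOp (opNegRow i)       M (suc r) (suc c) = refl
1⊕-applyOp (opAddRow i j _ a) M zero    zero    = refl
1⊕-applyOp (opAddRow i j _ a) M zero    (suc c) = refl
1⊕-applyOp (opAddRow i j _ a) M (suc r) zero    = if-both _ (0+a*0≡0 a) refl
1⊕-applyOp (opAddRow i j _ a) M (suc r) (suc c) = refl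
1⊕-applyOp (opSwapRow i j)    M zero    zero    = refl
1⊕-applyOp (opSwapRow i j)    M zero    (suc c) = refl
1⊕-applyOp (opSwapRow i j)    M (suc r) zero    =
  if-both (does (r Fin.≟ i)) refl (if-both (does (r Fin.≟ j)) refl refl)
1⊕-applyOp (opSwapRow i j)    M (suc r) (suc c) = refl
1⊕-applyOp (opNegCol i)       M zero    zero    = refl
1⊕-applyOp (opNegCol i)       M zero    (suc c) = if-both _ refl refl
1⊕-applyOp (opNegCol i)       M (suc r) zero    = refl
1⊕-applyOp (opNegCol i)       M (suc r) (suc c) = refl
1⊕-applyOp (opAddCol i j _ a) M zero    zero    = refl
1⊕-applyOp (opAddCol i j _ a) M zero    (suc c) = if-both _ (0+a*0≡0 a) refl
1⊕-applyOp (opAddCol i j _ a) M (suc r) zero    = refl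
1⊕-applyOp (opAddCol i j _ a) M (suc r) (suc c) = refl
1⊕-applyOp (opSwapCol i j)    M zero    zero    = refl
1⊕-applyOp (opSwapCol i j)    M zero    (suc c) =
  if-both (does (c Fin.≟ i)) refl (if-both (does (c Fin.≟ j)) refl refl)
1⊕-applyOp (opSwapCol i j)    M (suc r) zero    = refl
1⊕-applyOp (opSwapCol i j)    M (suc r) (suc c) = refl

1⊕-cong : {M N : Matrix m n} → M ≗ₘ N → 1⊕ M ≗ₘ 1⊕ N
1⊕-cong M≗N zero    zero    = refl
1⊕-cong M≗N zero    (suc c) = refl
1⊕-cong M≗N (suc r) zero    = refl
1⊕-cong M≗N (suc r) (suc c) = M≗N r c

1⊕-∼ : {M N : Matrix m n} → M ∼ N → 1⊕ M ∼ 1⊕ N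
1⊕-∼ = gmap 1⊕_ step
  where
  step : {M N : Matrix m n} → Step M N → Step (1⊕ M) (1⊕ N)
  step {M = M} (o , eq) = 1⊕-op o , λ r c → trans (1⊕-applyOp o M r c) (1⊕-cong eq r c)

<ᵇ-irrefl : ∀ k → (k <ᵇ k) ≡ false
<ᵇ-irrefl zero    = refl
<ᵇ-irrefl (suc k) = <ᵇ-irrefl k

n<ᵇ1+n : ∀ k → (k <ᵇ suc k) ≡ true
n<ᵇ1+n zero    = refl
n<ᵇ1+n (suc k) = n<ᵇ1+n k

<ᵇ-suc : ∀ {x k} → x ≢ k → (x <ᵇ suc k) ≡ (x <ᵇ k)
<ᵇ-suc {zero}  {zero}  0≢0 = contradiction refl 0≢0
<ᵇ-suc {zero}  {suc k} _   = refl
<ᵇ-suc {suc x} {zero}  _   = refl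
<ᵇ-suc {suc x} {suc k} x≢k = <ᵇ-suc (x≢k ∘ cong suc)

toℕ<ᵇn : (i : Fin m) → (toℕ i <ᵇ m) ≡ true
toℕ<ᵇn zero    = refl
toℕ<ᵇn (suc i) = toℕ<ᵇn i

shearRows : (Fin m → ℤ) → Matrix (suc m) n → Matrix (suc m) n
shearRows a S zero    c = S zero c
shearRows a S (suc i) c = S (suc i) c + a i * S zero c

shearRows-∼ : (a : Fin m → ℤ) (S : Matrix (suc m) n) → S ∼ shearRows a S
shearRows-∼ {m = m} {n = n} a S = shearedBelow-∼ m ≤-refl ◅◅ ≗ₘ⇒∼ shearedBelow-all
  where
  shearedRow : Bool → Fin m → Fin n → ℤ
  shearedRow b i c = if b then shearRows a S (suc i) c else S (suc i) c

  shearedBelow : ℕ → Matrix (suc m) n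
  shearedBelow k zero    c = S zero c
  shearedBelow k (suc i) c = shearedRow (toℕ i <ᵇ k) i c

  shearedBelow-∼ : ∀ k → k ≤ m → S ∼ shearedBelow k
  shearedBelow-∼ zero    _   = ≗ₘ⇒∼ λ { zero c → refl ; (suc i) c → refl }
  shearedBelow-∼ (suc k) k<m =
    shearedBelow-∼ k (<⇒≤ k<m) ◅◅ (opAddRow (suc i₀) zero (λ ()) (a i₀) , next) ◅ ε
    where
    i₀ : Fin m
    i₀ = fromℕ< k<m
    next : addRow (suc i₀) zero (a i₀) (shearedBelow k) ≗ₘ shearedBelow (suc k)
    next zero    c = refl
    next (suc i) c with i Fin.≟ i₀
    ... | yes refl rewrite toℕ-fromℕ< k<m | <ᵇ-irrefl k | n<ᵇ1+n k = refl
    ... | no i≢i₀ = cong (λ b → shearedRow b i c) (sym (<ᵇ-suc toℕi≢k))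
      where
      toℕi≢k : toℕ i ≢ k
      toℕi≢k toℕi≡k = i≢i₀ (toℕ-injective (trans toℕi≡k (sym (toℕ-fromℕ< k<m))))

  shearedBelow-all : shearedBelow m ≗ₘ shearRows a S
  shearedBelow-all zero    c = refl
  shearedBelow-all (suc i) c = cong (λ b → shearedRow b i c) (toℕ<ᵇn i)

schur : Matrix (suc m) (suc n) → Matrix m n
schur S i j = S (suc i) (suc j) - S (suc i) zero * S zero (suc j)

unitPivot-∼ : (S : Matrix (suc m) (suc n)) → S zero zero ≡ 1ℤ → S ∼ 1⊕ schur S
unitPivot-∼ {m = m} {n = n} S S₀₀≡1 =
  shearRows-∼ (λ i → - S (suc i) zero) S ◅◅
  ᵀ-∼ (shearRows-∼ (λ j → - S zero (suc j)) (R ᵀ)) ◅◅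
  ≗ₘ⇒∼ cleared
  where
  R : Matrix (suc m) (suc n)
  R = shearRows (λ i → - S (suc i) zero) S

  x-x*1≡0 : ∀ x → x + - x * 1ℤ ≡ 0ℤ
  x-x*1≡0 = solve-∀

  schur-identity : ∀ y u v → (y + - u * v) + - v * (u + - u * 1ℤ) ≡ y - u * v
  schur-identity = solve-∀

  cleared : (shearRows (λ j → - S zero (suc j)) (R ᵀ)) ᵀ ≗ₘ 1⊕ schur S
  cleared zero    zero    = S₀₀≡1
  cleared zero    (suc j) rewrite S₀₀≡1 = x-x*1≡0 (S zero (suc j))
  cleared (suc i) zero    rewrite S₀₀≡1 = x-x*1≡0 (S (suc i) zero)
  cleared (suc i) (suc j) rewrite S₀₀≡1 =
    schur-identity (S (suc i) (suc j)) (S (suc i) zero) (S zero (suc j))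

m2-cong : ∀ {a a′ b b′ c c′ d d′ : ℤ} →
  a ≡ a′ → b ≡ b′ → c ≡ c′ → d ≡ d′ → m2 a b c d ≡ m2 a′ b′ c′ d′
m2-cong refl refl refl refl = refl

⊗-assoc : ∀ P Q R → (P ⊗ Q) ⊗ R ≡ P ⊗ (Q ⊗ R)
⊗-assoc (m2 a b c d) (m2 e f g h) (m2 i j k l) =
  m2-cong (entry a b e f g h i k) (entry a b e f g h j l) (entry c d e f g h i k) (entry c d e f g h j l)
  where
  entry : ∀ a b e f g h i k →
    (a * e + b * g) * i + (a * f + b * h) * k ≡ a * (e * i + f * k) + b * (g * i + h * k)
  entry = solve-∀

⊗-identityˡ : ∀ P → id2 ⊗ P ≡ P
⊗-identityˡ (m2 a b c d) = m2-cong (entry a c) (entry b d) (entry′ a c) (entry′ b d)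
  where
  entry : ∀ x y → 1ℤ * x + 0ℤ * y ≡ x
  entry = solve-∀
  entry′ : ∀ x y → 0ℤ * x + 1ℤ * y ≡ y
  entry′ = solve-∀

^2-⊗-comm : ∀ P n M → (P ^2 n) ⊗ (P ⊗ M) ≡ P ⊗ ((P ^2 n) ⊗ M)
^2-⊗-comm P zero M = trans (⊗-identityˡ (P ⊗ M)) (cong (P ⊗_) (sym (⊗-identityˡ M)))
^2-⊗-comm P (suc n) M = begin
  (P ⊗ (P ^2 n)) ⊗ (P ⊗ M)  ≡⟨ ⊗-assoc P (P ^2 n) (P ⊗ M) ⟩
  P ⊗ ((P ^2 n) ⊗ (P ⊗ M))  ≡⟨ cong (P ⊗_) (^2-⊗-comm P n M) ⟩
  P ⊗ (P ⊗ ((P ^2 n) ⊗ M))  ≡⟨ cong (P ⊗_) (⊗-assoc P (P ^2 n) M) ⟨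
  P ⊗ ((P ⊗ (P ^2 n)) ⊗ M)  ∎
  where open ≡-Reasoning

sub-*-if : ∀ b e {x y z y′ z′ s u v : ℤ} → y - s * u ≡ y′ → z - s * v ≡ z′ →
  (if b then x else if e then y else z) - s * (if b then 0ℤ else if e then u else v)
  ≡ (if b then x else if e then y′ else z′)
sub-*-if true  e {x} {s = s} _ _ = trans (cong (λ t → x - t) (ℤ.*-zeroʳ s)) (ℤ.+-identityʳ x)
sub-*-if false true  y-su≡y′ _ = y-su≡y′
sub-*-if false false _ z-sv≡z′ = z-sv≡z′

topRows : ℕ → ℤ → ℤ → ℤ
topRows i a c = if i ≡ᵇ 0 then a else if i ≡ᵇ 1 then c else 0ℤ

bottomRows : ℕ → ℕ → ℤ → ℤ → ℤ
bottomRows n i w y = if i ≡ᵇ n then w else if i ≡ᵇ suc n then y else 0ℤ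

corners-disjoint : ∀ m i (a c w y : ℤ) →
  (if i ≡ᵇ 0 then a else if i ≡ᵇ 1 then c else if i ≡ᵇ suc (suc m) then w
   else if i ≡ᵇ suc (suc (suc m)) then y else 0ℤ)
  ≡ topRows i a c + bottomRows (suc (suc m)) i w y
corners-disjoint m zero          a c w y = sym (ℤ.+-identityʳ a)
corners-disjoint m (suc zero)    a c w y = sym (ℤ.+-identityʳ c)
corners-disjoint m (suc (suc i)) a c w y = sym (ℤ.+-identityˡ _)

1⊕-Block : ∀ n R → 1⊕ Block (suc (suc n)) R ≗ₘ Block (suc (suc (suc n))) R
1⊕-Block n R zero    zero    = refl
1⊕-Block n R zero    (suc j) = refl
1⊕-Block n R (suc i) zero    = sym (if-both (toℕ i <ᵇ n) refl refl)
1⊕-Block n R (suc i) (suc j) = refl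

module Corners (q Δ : ℤ) where

  P : M2
  P = m2 Δ 1ℤ (- q) 0ℤ

  band : ℕ → ℕ → ℤ
  band i j = if i ≡ᵇ j then 1ℤ else if i ≡ᵇ suc j then - Δ else if i ≡ᵇ suc (suc j) then q else 0ℤ

  pivotColumn : ℕ → ℤ
  pivotColumn i = if i ≡ᵇ 0 then - Δ else if i ≡ᵇ 1 then q else 0ℤ

  -- a + 0ℤ is the entry A of the pivot row as M̃⁺ computes it.
  schur-row : ∀ i a c u →
    (topRows (suc i) a c + u) - pivotColumn i * (a + 0ℤ) ≡ topRows i (Δ * a + 1ℤ * c) (- q * a + 0ℤ * c) + u
  schur-row zero          a c u = row₀ Δ a c u
    where
    row₀ : ∀ δ a c u → (c + u) - - δ * (a + 0ℤ) ≡ (δ * a + 1ℤ * c) + u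
    row₀ = solve-∀
  schur-row (suc zero)    a c u = row₁ q a c u
    where
    row₁ : ∀ q a c u → (0ℤ + u) - q * (a + 0ℤ) ≡ (- q * a + 0ℤ * c) + u
    row₁ = solve-∀
  schur-row (suc (suc i)) a c u = row₂ a u
    where
    row₂ : ∀ a u → (0ℤ + u) - 0ℤ * (a + 0ℤ) ≡ 0ℤ + u
    row₂ = solve-∀

  module _ (N : M2) where

    M̃⁺-entry : ℕ → M2 → ℕ → ℕ → ℤ
    M̃⁺-entry n M i j =
      if j <ᵇ n then band i j
      else if j ≡ᵇ n then topRows i (e11 M) (e21 M) + bottomRows n i (e11 N) (e21 N)
      else topRows i (e12 M) (e22 M) + bottomRows n i (e12 N) (e22 N)

    M̃⁺ : (n : ℕ) → M2 → Matrix (suc (suc n)) (suc (suc n))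
    M̃⁺ n M i j = M̃⁺-entry n M (toℕ i) (toℕ j)

    schur-M̃⁺ : ∀ n M → schur (M̃⁺ (suc n) M) ≗ₘ M̃⁺ n (P ⊗ M)
    schur-M̃⁺ n M i j =
      sub-*-if (toℕ j <ᵇ n) (toℕ j ≡ᵇ n) {s = pivotColumn (toℕ i)}
        (schur-row (toℕ i) (e11 M) (e21 M) _) (schur-row (toℕ i) (e12 M) (e22 M) _)

    M̃⁺-zero : ∀ M → M̃⁺ zero M ≗ₘ Block 2 (M ⊕ N)
    M̃⁺-zero M zero       zero       = refl
    M̃⁺-zero M zero       (suc zero) = refl
    M̃⁺-zero M (suc zero) zero       = refl
    M̃⁺-zero M (suc zero) (suc zero) = refl

    M̃⁺-∼ : ∀ n M → M̃⁺ n M ∼ Block (suc (suc n)) (((P ^2 n) ⊗ M) ⊕ N)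
    M̃⁺-∼ zero M = ≗ₘ⇒∼ λ i j →
      trans (M̃⁺-zero M i j) (cong (λ R → Block 2 (R ⊕ N) i j) (sym (⊗-identityˡ M)))
    M̃⁺-∼ (suc n) M =
      unitPivot-∼ (M̃⁺ (suc n) M) refl ◅◅
      1⊕-∼ (≗ₘ⇒∼ (schur-M̃⁺ n M) ◅◅ M̃⁺-∼ n (P ⊗ M)) ◅◅
      ≗ₘ⇒∼ λ i j → trans (1⊕-Block n (((P ^2 n) ⊗ (P ⊗ M)) ⊕ N) i j)
                          (cong (λ R → Block (suc (suc (suc n))) (R ⊕ N) i j) P^n[PM]≡P^[1+n]M)
      where
      P^n[PM]≡P^[1+n]M : (P ^2 n) ⊗ (P ⊗ M) ≡ (P ^2 suc n) ⊗ M
      P^n[PM]≡P^[1+n]M = trans (^2-⊗-comm P n M) (sym (⊗-assoc P (P ^2 n) M))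

  Mtilde≗M̃⁺ : ∀ m A B C D W X Y Z →
    Mtilde (suc (suc (suc (suc m)))) q Δ A B C D W X Y Z ≗ₘ M̃⁺ (m2 W X Y Z) (suc (suc m)) (m2 A B C D)
  Mtilde≗M̃⁺ m A B C D W X Y Z i j =
    cong (λ t → if toℕ j <ᵇ suc (suc m) then band (toℕ i) (toℕ j) else t)
         (cong₂ (if_then_else_ (toℕ j ≡ᵇ suc (suc m)))
                (corners-disjoint m (toℕ i) A C W Y) (corners-disjoint m (toℕ i) B D X Z))

proposition8 : (k : ℕ) → 4 ≤ k → (q Δ A B C D W X Y Z : ℤ) →
    Mtilde k q Δ A B C D W X Y Z
      ∼ Block k ((((m2 Δ 1ℤ (- q) 0ℤ) ^2 (k ∸ 2)) ⊗ (m2 A B C D)) ⊕ (m2 W X Y Z))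
proposition8 _ (s≤s (s≤s (s≤s (s≤s (z≤n {m}))))) q Δ A B C D W X Y Z =
  ≗ₘ⇒∼ (Mtilde≗M̃⁺ m A B C D W X Y Z) ◅◅ M̃⁺-∼ (m2 W X Y Z) (suc (suc m)) (m2 A B C D)
  where open Corners q Δ
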